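{- Let $n \ge 7$ be an integer all of whose prime factors are congruent to $1$ modulo $6$, let $a$ be a solution of $x^2 - x + 1 \equiv 0 \pmod n$, and let $\Gamma = TL_n(a,a-1,1)$ (a 6-valent first-kind Frobenius circulant of order $n$). Then for every divisor $m$ of $n$ with $1 < m < n$, the quotient graph of $\Gamma$ with respect to the partition $\mathcal{P}(m)$ is isomorphic to a 6-valent first-kind Frobenius circulant of order $m$, namely $\Gamma(m) = TL_m(a_m, a_m-1, 1)$ for some solution $a_m$ of $x^2 - x + 1 \equiv 0 \pmod m$. Moreover, $\Gamma$ is an $(n/m)$-fold cover of $\Gamma(m)$.
   Context: $TL_N(a,b,c)$ is the Cayley graph on $\mathbb{Z}_N$ with connection set $\{\pm[a],\pm[b],\pm[c]\}$ (vertices $x,y$ adjacent iff $x-y$ is in the set). For a divisor $m>1$ of $n$, $K(m) = \{[km] : 0\le k\le n/m-1\}$ is the subgroup of $(\mathbb{Z}_n,+)$ generated by $[m]$, and $\mathcal{P}(m) = \{K(m)+[j] : 0 \le j \le m-1\}$ is the partition of $\mathbb{Z}_n$ into its cosets. The quotient graph of a graph $\Gamma$ with respect to a partition $\mathcal{P}$ of $V(\Gamma)$ has vertex set $\mathcal{P}$, two blocks being adjacent iff some edge of $\Gamma$ joins them. A $k$-fold cover of $\Gamma_2$ is a graph $\Gamma_1$ with a surjection $\phi:V(\Gamma_1)\to V(\Gamma_2)$ mapping each neighbourhood $N(u)$ bijectively onto $N(\phi(u))$ and with all fibres of size $k$. A first-kind Frobenius circulant: a Cayley graph $\mathrm{Cay}(K,a^H)$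 where $K\rtimes H$ is a Frobenius group (transitive, non-regular, only the identity fixes two points) with cyclic kernel $K$, point stabiliser $H$ acting by conjugation, $\langle a^H\rangle = K$, and $|H|$ even or $a$ an involution. -}

module Defs where

open import Data.Nat using (ℕ; _+_; _*_; _∸_; _<_; NonZero)
open import Data.Nat.DivMod using (_%_; _/_)
open import Data.Fin using (Fin; toℕ)
open import Data.List using (List; _∷_; [])
open import Data.List.Relation.Unary.Any using (Any)
open import Data.Product using (Σ; ∃; _×_; _,_)
open import Data.Sum using (_⊎_)
open import Function.Bundles using (_↔_; _⇔_; Inverse)
open import Relation.Binary.PropositionalEquality using (_≡_)
open import Data.List.Relation.Unary.Unique.Propositional using (Unique)

record Graph : Set₁ where
  constructor graph
  field
    V   : Set
    Adj : V → V → Set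
open Graph public

-- Cayley graph on Z_N (vertices Fin N = residues 0..N-1) with connection
-- set {±[s] : s ∈ S}:  x ~ y  iff  x - y ≡ ±s (mod N) for some s ∈ S.
CayAdj : (N : ℕ) .{{_ : NonZero N}} → List ℕ → Fin N → Fin N → Set
CayAdj N S x y =
  Any (λ s → ((toℕ y + s) % N ≡ toℕ x) ⊎ ((toℕ x + s) % N ≡ toℕ y)) S

Cay : (N : ℕ) .{{_ : NonZero N}} → List ℕ → Graph
Cay N S = graph (Fin N) (CayAdj N S)

TL : (N : ℕ) .{{_ : NonZero N}} → ℕ → ℕ → ℕ → Graph
TL N a b c = Cay N (a ∷ b ∷ c ∷ [])

-- x ∈ K(m) + [j]  in Z_n, where K(m) = {[k m] : 0 ≤ k ≤ n/m - 1}.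
InCoset : (n : ℕ) .{{_ : NonZero n}} → (m : ℕ) .{{_ : NonZero m}} → ℕ → Fin n → Set
InCoset n m j x = Σ ℕ (λ k → (k < n / m) × ((k * m + j) % n ≡ toℕ x))

-- Quotient graph of a graph on Z_n (vertices Fin n) w.r.t. P(m):
-- the block K(m)+[j] (0 ≤ j ≤ m-1) is represented by j : Fin m; two blocks
-- are adjacent iff some edge of the graph joins them.
Quotient : (n : ℕ) .{{_ : NonZero n}} → (Fin n → Fin n → Set) → (m : ℕ) .{{_ : NonZero m}} → Graph
Quotient n Adj m = graph (Fin m) (λ i j →
  Σ (Fin n) λ x → Σ (Fin n) λ y →
    InCoset n m (toℕ i) x × InCoset n m (toℕ j) y × Adj x y)

_≅_ : Graph → Graph → Set
Γ ≅ Δ = Σ (V Γ ↔ V Δ) λ f →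
  ∀ u v → Adj Γ u v ⇔ Adj Δ (Inverse.to f u) (Inverse.to f v)

IsCover : ℕ → Graph → Graph → Set
IsCover k Γ₁ Γ₂ = Σ (V Γ₁ → V Γ₂) λ φ →
    (∀ z → Σ (V Γ₁) λ u → φ u ≡ z)
  × (∀ u v → Adj Γ₁ u v → Adj Γ₂ (φ u) (φ v))
  × (∀ u v w → Adj Γ₁ u v → Adj Γ₁ u w → φ v ≡ φ w → v ≡ w)
  × (∀ u z → Adj Γ₂ (φ u) z → Σ (V Γ₁) λ v → Adj Γ₁ u v × φ v ≡ z)
  × (∀ z → Fin k ↔ Σ (V Γ₁) (λ u → φ u ≡ z))

-- The connection set {±[a], ±[b], ±[c]} of TL_N(a,b,c) has exactly 6
-- elements in Z_N (i.e. TL_N(a,b,c) is 6-valent).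
SixValent : (N : ℕ) .{{_ : NonZero N}} → ℕ → ℕ → ℕ → Set
SixValent N a b c = Unique (neg a ∷ a % N ∷ neg b ∷ b % N ∷ neg c ∷ c % N ∷ [])
  where
    neg : ℕ → ℕ
    neg s = (N ∸ s % N) % N

-- Write ζ = a, so that ζ² − ζ + 1 ≡ 0 and the connection set {±a, ±(a−1), ±1} is
-- {±ζ, ±(ζ−1), ±1}: the sixth roots of unity modulo every divisor m of n. Reduction modulo m
-- maps Z_n onto Z_m with the cosets of K(m) as fibres and turns a step by an offset o into a
-- step by o, so the quotient graph is the Cayley graph on Z_m with the same connection set.
-- Every difference of two of the six offsets, multiplied by a suitable polynomial in ζ, is
-- congruent to 2 or 3 modulo ζ² − ζ + 1; as m is prime to 6, the offsets remain pairwise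
-- incongruent modulo m. Hence TL_m(a, a−1, 1) is 6-valent and the projection is bijective on every
-- neighbourhood, i.e. an (n/m)-fold covering.

module Submission where

open import Defs
open import Data.Nat.Base using (ℕ; zero; suc; NonZero; _<_; _≤_)
open import Data.Nat.DivMod using (_%_; _/_)
open import Data.Nat.Divisibility using (_∣_)
open import Data.Integer.Base using (ℤ; +_; 0ℤ; 1ℤ)
open import Data.List.Base using (List; []; _∷_)
open import Data.List.Membership.Propositional using (_∈_)
open import Data.List.Relation.Unary.Any using (here; there)
open import Data.Product using (Σ; ∃-syntax; _×_; _,_)
open import Data.Sum using (inj₁; inj₂)
open import Data.Fin.Base using (Fin; toℕ)
open import Function using (_∘_; _⇔_; mk⇔; _↔_; mk↔ₛ′)
open import Function.Bundles using (Equivalence)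
open import Level using (0ℓ)
open import Relation.Nullary using (¬_; contradiction)
open import Relation.Binary.Bundles using (Setoid)
open import Relation.Binary.Structures using (IsEquivalence)
open import Relation.Binary.PropositionalEquality
  using (_≡_; refl; sym; trans; cong; subst; subst₂; cong₂; module ≡-Reasoning)
import Relation.Binary.Reasoning.Setoid as ≈-Reasoning
import Data.Nat.Base as ℕ
import Data.Nat.Properties as ℕ
import Data.Integer.Properties as ℤ

module Congruence where

  open import Data.Integer.Base using (_+_; _-_; _*_; -_)
  open import Data.Integer.DivMod using (_/ℕ_; n%ℕd<d; a≡a%ℕn+[a/ℕn]*n)
  open import Data.Integer.Divisibility.Signed as Signed using (divides)
  open import Data.Integer.Tactic.RingSolver using (solve)
  open import Data.Nat.DivMod using (m%n<n; m<n⇒m%n≡m; m≡m%n+[m/n]*n)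
  open import Data.Nat.Divisibility using (n∣m⇒m%n≡0)
  open import Data.Fin.Base using (fromℕ<)
  open import Data.Fin.Properties using (toℕ-fromℕ<; toℕ<n; toℕ-injective)

  infix 4 _≡_mod_
  record _≡_mod_ (x y : ℤ) (N : ℕ) : Set where
    constructor mod-divides
    field divides-difference : + N Signed.∣ x - y

  private variable
    x y z u v : ℤ
    N M : ℕ

  private
    mod-via : + N Signed.∣ z → z ≡ x - y → x ≡ y mod N
    mod-via h eq = mod-divides (subst (_ Signed.∣_) eq h)

  mod-refl : x ≡ x mod N
  mod-refl {x = x} = mod-divides (divides 0ℤ (ℤ.+-inverseʳ x))

  mod-sym : x ≡ y mod N → y ≡ x mod N
  mod-sym {x = x} {y = y} (mod-divides h) = mod-via (Signed.∣m⇒∣-m h) (solve (x ∷ y ∷ []))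

  mod-trans : x ≡ y mod N → y ≡ z mod N → x ≡ z mod N
  mod-trans {x = x} {y = y} {z = z} (mod-divides h) (mod-divides h′) =
    mod-via (Signed.∣m∣n⇒∣m+n h h′) (solve (x ∷ y ∷ z ∷ []))

  mod-isEquivalence : IsEquivalence (λ x y → x ≡ y mod N)
  mod-isEquivalence = record { refl = mod-refl ; sym = mod-sym ; trans = mod-trans }

  mod-setoid : ℕ → Setoid 0ℓ 0ℓ
  mod-setoid N = record { isEquivalence = mod-isEquivalence {N} }

  module mod-Reasoning (N : ℕ) = ≈-Reasoning (mod-setoid N)

  mod-+-cong : x ≡ y mod N → u ≡ v mod N → x + u ≡ y + v mod N
  mod-+-cong {x = x} {y = y} {u = u} {v = v} (mod-divides h) (mod-divides h′) =
    mod-via (Signed.∣m∣n⇒∣m+n h h′) (solve (x ∷ y ∷ u ∷ v ∷ []))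

  mod-+-congʳ : ∀ z → x ≡ y mod N → x + z ≡ y + z mod N
  mod-+-congʳ z x≡y = mod-+-cong x≡y mod-refl

  mod-+-cancelˡ : ∀ z → z + x ≡ z + y mod N → x ≡ y mod N
  mod-+-cancelˡ {x = x} {y = y} z (mod-divides h) = mod-via h (solve (x ∷ y ∷ z ∷ []))

  mod-*-congˡ : ∀ z → x ≡ y mod N → z * x ≡ z * y mod N
  mod-*-congˡ {x = x} {y = y} z (mod-divides h) =
    mod-via (Signed.∣n⇒∣m*n z h) (solve (x ∷ y ∷ z ∷ []))

  mod-neg-cong : x ≡ y mod N → - x ≡ - y mod N
  mod-neg-cong {x = x} {y = y} (mod-divides h) = mod-via (Signed.∣m⇒∣-m h) (solve (x ∷ y ∷ []))

  mod-∣ : M ∣ N → x ≡ y mod N → x ≡ y mod M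
  mod-∣ M∣N (mod-divides h) = mod-divides (Signed.∣-trans (Signed.∣ᵤ⇒∣ M∣N) h)

  mod-multiple : ∀ x k → x + k * + N ≡ x mod N
  mod-multiple {N = N} x k = mod-divides (divides k (x+y-x≡y x (k * + N)))
    where
    x+y-x≡y : ∀ x y → x + y - x ≡ y
    x+y-x≡y x y = solve (x ∷ y ∷ [])

  mod-0⇔∣ : ∀ w → + w ≡ 0ℤ mod N ⇔ N ∣ w
  mod-0⇔∣ {N = N} w = mk⇔
    (λ (mod-divides h) → Signed.∣⇒∣ᵤ (subst (+ N Signed.∣_) (ℤ.+-identityʳ (+ w)) h))
    (λ N∣w → mod-divides
      (subst (+ N Signed.∣_) (sym (ℤ.+-identityʳ (+ w))) (Signed.∣ᵤ⇒∣ N∣w)))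

  module _ .{{_ : NonZero N}} where

    mod-% : ∀ w → + (w % N) ≡ + w mod N
    mod-% w = subst (+ (w % N) ≡_mod N) w≡ (mod-sym (mod-multiple _ (+ (w / N))))
      where
      w≡ : + (w % N) + + (w / N) * + N ≡ + w
      w≡ = sym (trans (cong +_ (m≡m%n+[m/n]*n w N))
                 (trans (ℤ.pos-+ (w % N) _) (cong (_+_ (+ (w % N))) (ℤ.pos-* (w / N) N))))

    mod-∸-% : ∀ s → + ((N ℕ.∸ s % N) % N) ≡ - + s mod N
    mod-∸-% s = begin
      + ((N ℕ.∸ r) % N)  ≈⟨ mod-% (N ℕ.∸ r) ⟩
      + (N ℕ.∸ r)        ≡⟨ trans (ℤ.m-n≡m⊖n N r) (ℤ.⊖-≥ (ℕ.<⇒≤ (m%n<n s N))) ⟨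
      + N - + r          ≡⟨ n-r≡-r+1*n (+ N) (+ r) ⟩
      - + r + 1ℤ * + N   ≈⟨ mod-multiple (- + r) 1ℤ ⟩
      - + r              ≈⟨ mod-neg-cong (mod-% s) ⟩
      - + s              ∎
      where
      open mod-Reasoning N
      r : ℕ
      r = s % N
      n-r≡-r+1*n : ∀ n r → n - r ≡ - r + 1ℤ * n
      n-r≡-r+1*n n r = solve (n ∷ r ∷ [])

    private
      ≤-canonical : ∀ {i j} → i < N → j ≤ i → + i ≡ + j mod N → i ≡ j
      ≤-canonical {i} {j} i<N j≤i (mod-divides h) = ℕ.≤-antisym (ℕ.m∸n≡0⇒m≤n i∸j≡0) j≤i
        where
        N∣i∸j : N ∣ i ℕ.∸ j
        N∣i∸j = Signed.∣⇒∣ᵤ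
          (subst (+ N Signed.∣_) (trans (ℤ.m-n≡m⊖n i j) (ℤ.⊖-≥ j≤i)) h)
        i∸j≡0 : i ℕ.∸ j ≡ 0
        i∸j≡0 = trans (sym (m<n⇒m%n≡m (ℕ.≤-<-trans (ℕ.m∸n≤m i j) i<N)))
                      (n∣m⇒m%n≡0 _ N N∣i∸j)

    mod-canonical : ∀ {i j} → i < N → j < N → + i ≡ + j mod N → i ≡ j
    mod-canonical {i} {j} i<N j<N i≡j with ℕ.≤-total j i
    ... | inj₁ j≤i = ≤-canonical i<N j≤i i≡j
    ... | inj₂ i≤j = sym (≤-canonical j<N i≤j (mod-sym i≡j))

    %≡⇔mod : ∀ {j} w → j < N → (w % N ≡ j) ⇔ (+ j ≡ + w mod N)
    %≡⇔mod w j<N = mk⇔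
      (λ w%N≡j → subst (λ r → + r ≡ + w mod N) w%N≡j (mod-% w))
      (λ j≡w → mod-canonical (m%n<n w N) j<N (mod-trans (mod-% w) (mod-sym j≡w)))

    reduce : ℤ → Fin N
    reduce t = fromℕ< (n%ℕd<d t N)

    mod-reduce : ∀ t → + toℕ (reduce t) ≡ t mod N
    mod-reduce t = subst₂ (λ r t′ → + r ≡ t′ mod N) (sym (toℕ-fromℕ< (n%ℕd<d t N)))
      (sym (a≡a%ℕn+[a/ℕn]*n t N)) (mod-sym (mod-multiple _ (t /ℕ N)))

  mod-transpose : x ≡ y + z mod N ⇔ y ≡ x - z mod N
  mod-transpose {x = x} {y = y} {z = z} = mk⇔
    (λ (mod-divides h) → mod-via (Signed.∣m⇒∣-m h) (solve (x ∷ y ∷ z ∷ [])))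
    (λ (mod-divides h) → mod-via (Signed.∣m⇒∣-m h) (solve (x ∷ y ∷ z ∷ [])))

  mod-toℕ-injective : ∀ {i j : Fin N} → + toℕ i ≡ + toℕ j mod N → i ≡ j
  mod-toℕ-injective {N = suc _} {i} {j} = toℕ-injective ∘ mod-canonical (toℕ<n i) (toℕ<n j)

open Congruence
open import Data.List.Relation.Unary.All as All using (All; []; _∷_)
open import Data.List.Relation.Unary.AllPairs using (AllPairs; []; _∷_)
open import Data.List.Relation.Binary.Pointwise using (Pointwise; []; _∷_)

DistinctMod : ℕ → List ℤ → Set
DistinctMod N = AllPairs (λ x y → ¬ x ≡ y mod N)

distinctMod-∈ : ∀ {N xs x y} → DistinctMod N xs → x ∈ xs → y ∈ xs → x ≡ y mod N → x ≡ y
distinctMod-∈ (_ ∷ _) (here refl) (here refl) _ = refl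
distinctMod-∈ (x≢ ∷ _) (here refl) (there y∈) x≡y = contradiction x≡y (All.lookup x≢ y∈)
distinctMod-∈ (y≢ ∷ _) (there x∈) (here refl) x≡y =
  contradiction (mod-sym x≡y) (All.lookup y≢ x∈)
distinctMod-∈ (_ ∷ d) (there x∈) (there y∈) x≡y = distinctMod-∈ d x∈ y∈ x≡y

module Shifts where

  open import Data.Integer.Base using (_+_; _-_; -_)
  open import Data.Fin.Properties using (toℕ<n)

  offsets : List ℕ → List ℤ
  offsets [] = []
  offsets (s ∷ S) = - + s ∷ + s ∷ offsets S

  Shift : (N : ℕ) → List ℕ → Fin N → Fin N → Set
  Shift N S x y = ∃[ o ] o ∈ offsets S × + toℕ y ≡ + toℕ x + o mod N

  module _ {N : ℕ} .{{_ : NonZero N}} where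

    private
      %-+≡⇔mod : ∀ w s (j : Fin N) → ((w ℕ.+ s) % N ≡ toℕ j) ⇔ (+ toℕ j ≡ + w + + s mod N)
      %-+≡⇔mod w s j = subst (λ t → ((w ℕ.+ s) % N ≡ toℕ j) ⇔ (+ toℕ j ≡ t mod N))
                         (ℤ.pos-+ w s) (%≡⇔mod (w ℕ.+ s) (toℕ<n j))

    cayAdj⇒shift : ∀ {S x y} → CayAdj N S x y → Shift N S x y
    cayAdj⇒shift {s ∷ _} {x} {y} (here (inj₁ y+s≡x)) =
      - + s , here refl ,
      Equivalence.to (mod-transpose {z = + s}) (Equivalence.to (%-+≡⇔mod (toℕ y) s x) y+s≡x)
    cayAdj⇒shift {s ∷ _} {x} {y} (here (inj₂ x+s≡y)) =
      + s , there (here refl) , Equivalence.to (%-+≡⇔mod (toℕ x) s y) x+s≡y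
    cayAdj⇒shift (there x~y) with cayAdj⇒shift x~y
    ... | o , o∈ , y≡x+o = o , there (there o∈) , y≡x+o

    shift⇒cayAdj : ∀ {S x y} → Shift N S x y → CayAdj N S x y
    shift⇒cayAdj {s ∷ _} {x} {y} (_ , here refl , y≡x-s) =
      here (inj₁ (Equivalence.from (%-+≡⇔mod (toℕ y) s x)
                   (Equivalence.from (mod-transpose {z = + s}) y≡x-s)))
    shift⇒cayAdj {s ∷ _} {x} {y} (_ , there (here refl) , y≡x+s) =
      here (inj₂ (Equivalence.from (%-+≡⇔mod (toℕ x) s y) y≡x+s))
    shift⇒cayAdj {_ ∷ _} (o , there (there o∈) , y≡x+o) = there (shift⇒cayAdj (o , o∈ , y≡x+o))

open Shifts

module SixthRoots where

  open import Data.Integer.Base using (_+_; _-_; _*_; -_)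
  open import Data.Integer.Tactic.RingSolver using (solve)
  open import Data.List.Base using ([_])

  module _ {m : ℕ} (ζ : ℤ) (ζ²+1-ζ≡0 : ζ * ζ + 1ℤ - ζ ≡ 0ℤ mod m)
           (2≢0 : ¬ + 2 ≡ 0ℤ mod m) (3≢0 : ¬ + 3 ≡ 0ℤ mod m) where

    private
      ≢0-by : ∀ t p q {c} → ¬ c ≡ 0ℤ mod m → c ≡ p * (ζ * ζ + 1ℤ - ζ) + q * t →
              ¬ t ≡ 0ℤ mod m
      ≢0-by t p q {c} c≢0 c≡ t≡0 = c≢0 (begin
        c                            ≡⟨ c≡ ⟩
        p * (ζ * ζ + 1ℤ - ζ) + q * t
          ≈⟨ mod-+-cong (mod-*-congˡ p ζ²+1-ζ≡0) (mod-*-congˡ q t≡0) ⟩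
        p * 0ℤ + q * 0ℤ              ≡⟨ cong₂ _+_ (ℤ.*-zeroʳ p) (ℤ.*-zeroʳ q) ⟩
        0ℤ                           ∎)
        where open mod-Reasoning m

      incongruent : ∀ x y {t} → ¬ t ≡ 0ℤ mod m → x - y ≡ t → ¬ x ≡ y mod m
      incongruent x y {t} t≢0 x-y≡t x≡y = t≢0 (begin
        t      ≡⟨ x-y≡t ⟨
        x - y  ≈⟨ mod-+-congʳ (- y) x≡y ⟩
        y - y  ≡⟨ ℤ.+-inverseʳ y ⟩
        0ℤ     ∎)
        where open mod-Reasoning m

      1≢0 : ¬ 1ℤ ≡ 0ℤ mod m
      1≢0 = ≢0-by 1ℤ 0ℤ (+ 2) 2≢0 (solve [ ζ ])

      ζ≢0 : ¬ ζ ≡ 0ℤ mod m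
      ζ≢0 = ≢0-by ζ (+ 2) (+ 2 - + 2 * ζ) 2≢0 (solve [ ζ ])

      ζ-1≢0 : ¬ ζ - 1ℤ ≡ 0ℤ mod m
      ζ-1≢0 = ≢0-by (ζ - 1ℤ) (+ 2) (- (+ 2 * ζ)) 2≢0 (solve [ ζ ])

      ζ-2≢0 : ¬ ζ - + 2 ≡ 0ℤ mod m
      ζ-2≢0 = ≢0-by (ζ - + 2) 1ℤ (- (ζ + 1ℤ)) 3≢0 (solve [ ζ ])

      ζ+1≢0 : ¬ ζ + 1ℤ ≡ 0ℤ mod m
      ζ+1≢0 = ≢0-by (ζ + 1ℤ) 1ℤ (+ 2 - ζ) 3≢0 (solve [ ζ ])

      2ζ≢0 : ¬ + 2 * ζ ≡ 0ℤ mod m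
      2ζ≢0 = ≢0-by (+ 2 * ζ) (+ 2) (1ℤ - ζ) 2≢0 (solve [ ζ ])

      2ζ-1≢0 : ¬ + 2 * ζ - 1ℤ ≡ 0ℤ mod m
      2ζ-1≢0 = ≢0-by (+ 2 * ζ - 1ℤ) (+ 4) (1ℤ - + 2 * ζ) 3≢0 (solve [ ζ ])

      2ζ-2≢0 : ¬ + 2 * ζ - + 2 ≡ 0ℤ mod m
      2ζ-2≢0 = ≢0-by (+ 2 * ζ - + 2) (+ 2) (- ζ) 2≢0 (solve [ ζ ])

    sixthRoots-distinct : DistinctMod m (- ζ ∷ ζ ∷ - (ζ - 1ℤ) ∷ ζ - 1ℤ ∷ - 1ℤ ∷ 1ℤ ∷ [])
    sixthRoots-distinct =
      ( incongruent ζ (- ζ) 2ζ≢0 (solve [ ζ ]) ∘ mod-sym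
      ∷ incongruent (- (ζ - 1ℤ)) (- ζ) 1≢0 (solve [ ζ ]) ∘ mod-sym
      ∷ incongruent (ζ - 1ℤ) (- ζ) 2ζ-1≢0 (solve [ ζ ]) ∘ mod-sym
      ∷ incongruent (- 1ℤ) (- ζ) ζ-1≢0 (solve [ ζ ]) ∘ mod-sym
      ∷ incongruent 1ℤ (- ζ) ζ+1≢0 (solve [ ζ ]) ∘ mod-sym
      ∷ [])
      ∷ ( incongruent ζ (- (ζ - 1ℤ)) 2ζ-1≢0 (solve [ ζ ])
        ∷ incongruent ζ (ζ - 1ℤ) 1≢0 (solve [ ζ ])
        ∷ incongruent ζ (- 1ℤ) ζ+1≢0 (solve [ ζ ])
        ∷ incongruent ζ 1ℤ ζ-1≢0 (solve [ ζ ])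
        ∷ [])
      ∷ ( incongruent (ζ - 1ℤ) (- (ζ - 1ℤ)) 2ζ-2≢0 (solve [ ζ ]) ∘ mod-sym
        ∷ incongruent (- 1ℤ) (- (ζ - 1ℤ)) ζ-2≢0 (solve [ ζ ]) ∘ mod-sym
        ∷ incongruent 1ℤ (- (ζ - 1ℤ)) ζ≢0 (solve [ ζ ]) ∘ mod-sym
        ∷ [])
      ∷ ( incongruent (ζ - 1ℤ) (- 1ℤ) ζ≢0 (solve [ ζ ])
        ∷ incongruent (ζ - 1ℤ) 1ℤ ζ-2≢0 (solve [ ζ ])
        ∷ [])
      ∷ (incongruent 1ℤ (- 1ℤ) 2≢0 (solve [ ζ ]) ∘ mod-sym ∷ [])
      ∷ []
      ∷ []

  offsets-distinct : ∀ {m} b → m ∣ suc b ℕ.* suc b ℕ.+ 1 ℕ.∸ suc b → ¬ m ∣ 2 → ¬ m ∣ 3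
                   → DistinctMod m (offsets (suc b ∷ b ∷ 1 ∷ []))
  offsets-distinct {m} b m∣a²+1-a m∤2 m∤3 = sixthRoots-distinct (+ a) a²+1-a≡0
    (m∤2 ∘ Equivalence.to (mod-0⇔∣ 2)) (m∤3 ∘ Equivalence.to (mod-0⇔∣ 3))
    where
    a : ℕ
    a = suc b
    a≤a²+1 : a ≤ a ℕ.* a ℕ.+ 1
    a≤a²+1 = ℕ.≤-trans (ℕ.m≤m*n a a) (ℕ.m≤m+n (a ℕ.* a) 1)
    pos-a²+1-a : + (a ℕ.* a ℕ.+ 1 ℕ.∸ a) ≡ + a * + a + 1ℤ - + a
    pos-a²+1-a = begin
      + (a ℕ.* a ℕ.+ 1 ℕ.∸ a)   ≡⟨ trans (ℤ.m-n≡m⊖n (a ℕ.* a ℕ.+ 1) a) (ℤ.⊖-≥ a≤a²+1) ⟨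
      + (a ℕ.* a ℕ.+ 1) - + a   ≡⟨ cong (_- + a) (ℤ.pos-+ (a ℕ.* a) 1) ⟩
      + (a ℕ.* a) + 1ℤ - + a    ≡⟨ cong (λ t → t + 1ℤ - + a) (ℤ.pos-* a a) ⟩
      + a * + a + 1ℤ - + a      ∎
      where open ≡-Reasoning
    a²+1-a≡0 : + a * + a + 1ℤ - + a ≡ 0ℤ mod m
    a²+1-a≡0 = subst (_≡ 0ℤ mod m) pos-a²+1-a (Equivalence.from (mod-0⇔∣ _) m∣a²+1-a)

open SixthRoots using (offsets-distinct)

module Projection {n m : ℕ} .{{_ : NonZero n}} .{{_ : NonZero m}} (m∣n : m ∣ n) where

  open import Data.Nat.Base using (_+_; _*_)
  open import Data.Nat.DivMod
    using (m%n<n; m<n⇒m%n≡m; m≡m%n+[m/n]*n; [m+kn]%n≡m%n; m/n*n≡m; m<n*o⇒m/o<n;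
           m∣n⇒o%n%m≡o%m; +-distrib-/-∣ˡ; m*n/n≡m; m<n⇒m/n≡0)
  open import Data.Nat.Divisibility using (∣⇒≤; n∣m*n)
  open import Data.Fin.Base using (fromℕ<; inject≤)
  open import Data.Fin.Properties using (toℕ<n; toℕ-fromℕ<; toℕ-inject≤; toℕ-injective; _≟_)
  open import Axiom.UniquenessOfIdentityProofs using (module Decidable⇒UIP)
  open ≡-Reasoning

  π : Fin n → Fin m
  π u = fromℕ< (m%n<n (toℕ u) m)

  toℕ-π : ∀ u → toℕ (π u) ≡ toℕ u % m
  toℕ-π u = toℕ-fromℕ< (m%n<n (toℕ u) m)

  ι : Fin m → Fin n
  ι z = inject≤ z (∣⇒≤ m∣n)

  π∘ι : ∀ z → π (ι z) ≡ z
  π∘ι z = toℕ-injective (begin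
    toℕ (π (ι z))  ≡⟨ toℕ-π (ι z) ⟩
    toℕ (ι z) % m  ≡⟨ cong (_% m) (toℕ-inject≤ z (∣⇒≤ m∣n)) ⟩
    toℕ z % m      ≡⟨ m<n⇒m%n≡m (toℕ<n z) ⟩
    toℕ z          ∎)

  private
    [km+j]%m≡j : ∀ k {j} → j < m → (k * m + j) % m ≡ j
    [km+j]%m≡j k {j} j<m = trans (cong (_% m) (ℕ.+-comm (k * m) j))
                             (trans ([m+kn]%n≡m%n j k m) (m<n⇒m%n≡m j<m))

    [km+j]/m≡k : ∀ k {j} → j < m → (k * m + j) / m ≡ k
    [km+j]/m≡k k {j} j<m = begin
      (k * m + j) / m    ≡⟨ +-distrib-/-∣ˡ j (n∣m*n k) ⟩
      k * m / m + j / m  ≡⟨ cong₂ _+_ (m*n/n≡m k m) (m<n⇒m/n≡0 j<m) ⟩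
      k + 0              ≡⟨ ℕ.+-identityʳ k ⟩
      k                  ∎

    [u/m]m+u%m≡u : ∀ u → u / m * m + u % m ≡ u
    [u/m]m+u%m≡u u = trans (ℕ.+-comm (u / m * m) (u % m)) (sym (m≡m%n+[m/n]*n u m))

    km+j<n : ∀ {k j} → k < n / m → j < m → k * m + j < n
    km+j<n {k} k<n/m j<m = ℕ.<-≤-trans (ℕ.+-monoʳ-< (k * m) j<m)
      (subst₂ _≤_ (ℕ.+-comm m (k * m)) (m/n*n≡m m∣n) (ℕ.*-monoˡ-≤ m k<n/m))

    u/m<n/m : ∀ (u : Fin n) → toℕ u / m < n / m
    u/m<n/m u = m<n*o⇒m/o<n (subst (toℕ u <_) (sym (m/n*n≡m m∣n)) (toℕ<n u))

  inCoset⇔π : ∀ z u → InCoset n m (toℕ z) u ⇔ π u ≡ z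
  inCoset⇔π z u = mk⇔ to from
    where
    to : InCoset n m (toℕ z) u → π u ≡ z
    to (k , _ , [km+z]%n≡u) = toℕ-injective (begin
      toℕ (π u)                ≡⟨ toℕ-π u ⟩
      toℕ u % m                ≡⟨ cong (_% m) [km+z]%n≡u ⟨
      (k * m + toℕ z) % n % m  ≡⟨ m∣n⇒o%n%m≡o%m m n (k * m + toℕ z) m∣n ⟩
      (k * m + toℕ z) % m      ≡⟨ [km+j]%m≡j k (toℕ<n z) ⟩
      toℕ z                    ∎)
    from : π u ≡ z → InCoset n m (toℕ z) u
    from refl = toℕ u / m , u/m<n/m u , (begin
      (toℕ u / m * m + toℕ (π u)) % n  ≡⟨ cong (λ r → (toℕ u / m * m + r) % n) (toℕ-π u) ⟩
      (toℕ u / m * m + toℕ u % m) % n  ≡⟨ cong (_% n) ([u/m]m+u%m≡u (toℕ u)) ⟩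
      toℕ u % n                        ≡⟨ m<n⇒m%n≡m (toℕ<n u) ⟩
      toℕ u                            ∎)

  fibre↔ : ∀ z → Fin (n / m) ↔ Σ (Fin n) (λ u → π u ≡ z)
  fibre↔ z = mk↔ₛ′ to from to∘from from∘to
    where
    lift : Fin (n / m) → Fin n
    lift k = fromℕ< (km+j<n (toℕ<n k) (toℕ<n z))

    toℕ-lift : ∀ k → toℕ (lift k) ≡ toℕ k * m + toℕ z
    toℕ-lift k = toℕ-fromℕ< (km+j<n (toℕ<n k) (toℕ<n z))

    to : Fin (n / m) → Σ (Fin n) (λ u → π u ≡ z)
    to k = lift k , toℕ-injective (begin
      toℕ (π (lift k))  ≡⟨ toℕ-π (lift k) ⟩
      toℕ (lift k) % m  ≡⟨ cong (_% m) (toℕ-lift k) ⟩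
      (toℕ k * m + toℕ z) % m ≡⟨ [km+j]%m≡j (toℕ k) (toℕ<n z) ⟩
      toℕ z             ∎)

    from : Σ (Fin n) (λ u → π u ≡ z) → Fin (n / m)
    from (u , _) = fromℕ< (u/m<n/m u)

    to∘from : ∀ w → to (from w) ≡ w
    to∘from (u , refl) = fibre-≡ (toℕ-injective (begin
      toℕ (lift (from (u , refl)))           ≡⟨ toℕ-lift (from (u , refl)) ⟩
      toℕ (from (u , refl)) * m + toℕ (π u)
        ≡⟨ cong₂ (λ q r → q * m + r) (toℕ-fromℕ< (u/m<n/m u)) (toℕ-π u) ⟩
      toℕ u / m * m + toℕ u % m              ≡⟨ [u/m]m+u%m≡u (toℕ u) ⟩
      toℕ u                                  ∎))
      where
      fibre-≡ : ∀ {v} {p : π v ≡ π u} {q : π u ≡ π u} → v ≡ u → (v , p) ≡ (u , q)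
      fibre-≡ refl = cong (u ,_) (Decidable⇒UIP.≡-irrelevant _≟_ _ _)

    from∘to : ∀ k → from (to k) ≡ k
    from∘to k = toℕ-injective (begin
      toℕ (from (to k))      ≡⟨ toℕ-fromℕ< (u/m<n/m (lift k)) ⟩
      toℕ (lift k) / m       ≡⟨ cong (_/ m) (toℕ-lift k) ⟩
      (toℕ k * m + toℕ z) / m ≡⟨ [km+j]/m≡k (toℕ k) (toℕ<n z) ⟩
      toℕ k                  ∎)

module Covering {n m : ℕ} .{{_ : NonZero n}} .{{_ : NonZero m}} (m∣n : m ∣ n) where

  open import Data.Integer.Base using (_+_)
  open import Function.Construct.Identity using (↔-id)
  open Projection m∣n

  mod-π : ∀ u → + toℕ (π u) ≡ + toℕ u mod m
  mod-π u = subst (λ r → + r ≡ + toℕ u mod m) (sym (toℕ-π u)) (mod-% (toℕ u))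

  π-≡⇒mod : ∀ {v w} → π v ≡ π w → + toℕ v ≡ + toℕ w mod m
  π-≡⇒mod {v} {w} πv≡πw =
    mod-trans (mod-sym (mod-π v)) (subst (λ r → + toℕ r ≡ + toℕ w mod m) (sym πv≡πw) (mod-π w))

  module _ {S : List ℕ} where

    shift-π : ∀ {x y} → Shift n S x y → Shift m S (π x) (π y)
    shift-π {x} {y} (o , o∈ , y≡x+o) = o , o∈ , (begin
      + toℕ (π y)      ≈⟨ mod-π y ⟩
      + toℕ y          ≈⟨ mod-∣ m∣n y≡x+o ⟩
      + toℕ x + o      ≈⟨ mod-+-congʳ o (mod-π x) ⟨
      + toℕ (π x) + o  ∎)
      where open mod-Reasoning m

    shift-lift : ∀ u {z} → Shift m S (π u) z → Σ (Fin n) λ v → Shift n S u v × π v ≡ z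
    shift-lift u {z} (o , o∈ , z≡πu+o) = v , (o , o∈ , mod-reduce _) , mod-toℕ-injective (begin
      + toℕ (π v)      ≈⟨ mod-π v ⟩
      + toℕ v          ≈⟨ mod-∣ m∣n (mod-reduce _) ⟩
      + toℕ u + o      ≈⟨ mod-+-congʳ o (mod-π u) ⟨
      + toℕ (π u) + o  ≈⟨ z≡πu+o ⟨
      + toℕ z          ∎)
      where
      v : Fin n
      v = reduce (+ toℕ u + o)
      open mod-Reasoning m

    shift-π-injective : DistinctMod m (offsets S) →
                        ∀ {u v w} → Shift n S u v → Shift n S u w → π v ≡ π w → v ≡ w
    shift-π-injective distinct {u} {v} {w} (o , o∈ , v≡u+o) (o′ , o′∈ , w≡u+o′) πv≡πw =
      mod-toℕ-injective (begin
        + toℕ v       ≈⟨ v≡u+o ⟩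
        + toℕ u + o   ≡⟨ cong (_+_ (+ toℕ u)) o≡o′ ⟩
        + toℕ u + o′  ≈⟨ w≡u+o′ ⟨
        + toℕ w       ∎)
      where
      open mod-Reasoning n
      u+o≡u+o′ : + toℕ u + o ≡ + toℕ u + o′ mod m
      u+o≡u+o′ = mod-trans (mod-sym (mod-∣ m∣n v≡u+o))
                   (mod-trans (π-≡⇒mod πv≡πw) (mod-∣ m∣n w≡u+o′))
      o≡o′ : o ≡ o′
      o≡o′ = distinctMod-∈ distinct o∈ o′∈ (mod-+-cancelˡ (+ toℕ u) u+o≡u+o′)

    cayAdj-π : ∀ {x y} → CayAdj n S x y → CayAdj m S (π x) (π y)
    cayAdj-π {x} {y} x~y = shift⇒cayAdj {S = S} (shift-π (cayAdj⇒shift {S = S} {x} {y} x~y))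

    cayAdj-lift : ∀ u z → CayAdj m S (π u) z → Σ (Fin n) λ v → CayAdj n S u v × π v ≡ z
    cayAdj-lift u z πu~z =
      let v , u→v , πv≡z = shift-lift u (cayAdj⇒shift {S = S} {π u} {z} πu~z)
      in  v , shift⇒cayAdj {S = S} u→v , πv≡z

  quotient≅ : ∀ S → Quotient n (CayAdj n S) m ≅ Cay m S
  quotient≅ S = ↔-id (Fin m) , λ i j → mk⇔ to from
    where
    to : ∀ {i j} → Adj (Quotient n (CayAdj n S) m) i j → CayAdj m S i j
    to {i} {j} (x , y , x∈i , y∈j , x~y) =
      subst₂ (CayAdj m S) (Equivalence.to (inCoset⇔π i x) x∈i) (Equivalence.to (inCoset⇔π j y) y∈j)
        (cayAdj-π x~y)
    from : ∀ {i j} → CayAdj m S i j → Adj (Quotient n (CayAdj n S) m) i j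
    from {i} {j} i~j =
      let v , ιi~v , πv≡j = cayAdj-lift (ι i) j (subst (λ k → CayAdj m S k j) (sym (π∘ι i)) i~j)
      in  ι i , v , Equivalence.from (inCoset⇔π i (ι i)) (π∘ι i) ,
          Equivalence.from (inCoset⇔π j v) πv≡j , ιi~v

  isCover : ∀ {S} → DistinctMod m (offsets S) → IsCover (n / m) (Cay n S) (Cay m S)
  isCover distinct =
    π , (λ z → ι z , π∘ι z) , (λ _ _ → cayAdj-π) ,
    (λ _ _ _ u~v u~w → shift-π-injective distinct (cayAdj⇒shift u~v) (cayAdj⇒shift u~w)) ,
    cayAdj-lift , fibre↔

allPairs-pointwise : ∀ {A B : Set} {R : A → B → Set} {P : B → B → Set} {Q : A → A → Set} →
                     (∀ {x x′ y y′} → R x y → R x′ y′ → P y y′ → Q x x′) →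
                     ∀ {xs ys} → Pointwise R xs ys → AllPairs P ys → AllPairs Q xs
allPairs-pointwise {R = R} {P} {Q} f = go
  where
  all-pointwise : ∀ {x y xs ys} → R x y → Pointwise R xs ys → All (P y) ys → All (Q x) xs
  all-pointwise x∼y [] [] = []
  all-pointwise x∼y (x′∼y′ ∷ rs) (p ∷ ps) = f x∼y x′∼y′ p ∷ all-pointwise x∼y rs ps
  go : ∀ {xs ys} → Pointwise R xs ys → AllPairs P ys → AllPairs Q xs
  go [] [] = []
  go (x∼y ∷ rs) (ps ∷ pss) = all-pointwise x∼y rs ps ∷ go rs pss

sixValent : ∀ {N} .{{_ : NonZero N}} {a b c} →
            DistinctMod N (offsets (a ∷ b ∷ c ∷ [])) → SixValent N a b c
sixValent {N} {a = a} {b} {c} = allPairs-pointwise {R = λ r o → + r ≡ o mod N} residues-distinct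
  (mod-∸-% a ∷ mod-% a ∷ mod-∸-% b ∷ mod-% b ∷ mod-∸-% c ∷ mod-% c ∷ [])
  where
  residues-distinct : ∀ {r r′ x y} →
                      + r ≡ x mod N → + r′ ≡ y mod N → ¬ x ≡ y mod N → ¬ r ≡ r′
  residues-distinct r≡x r′≡y x≢y refl = x≢y (mod-trans (mod-sym r≡x) r′≡y)

open import Data.Nat.Base using (_+_; _*_; _∸_)
open import Data.Nat.Divisibility using (∣-trans; ∣1⇒≡1)
open import Data.Nat.Primality using (Prime; prime[2]; prime?; prime⇒irreducible)
open import Relation.Nullary.Decidable using (from-yes)
open Covering using (quotient≅; isCover)

divisor∤prime : ∀ {n m q} → (∀ p → Prime p → p ∣ n → p % 6 ≡ 1) → m ∣ n → 1 < m →
                Prime q → ¬ q % 6 ≡ 1 → ¬ m ∣ q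
divisor∤prime primes≡1 m∣n 1<m q-prime q≢1 m∣q with prime⇒irreducible q-prime m∣q
... | inj₁ refl = ℕ.<-irrefl refl 1<m
... | inj₂ refl = q≢1 (primes≡1 _ q-prime m∣n)

theorem4p3 : (n : ℕ) .{{_ : NonZero n}} → 7 ≤ n
    → (∀ p → Prime p → p ∣ n → p % 6 ≡ 1)
    → (a : ℕ) → n ∣ (a * a + 1 ∸ a)
    → (m : ℕ) .{{_ : NonZero m}} → m ∣ n → 1 < m → m < n
    → Σ ℕ λ aₘ → (m ∣ (aₘ * aₘ + 1 ∸ aₘ))
        × SixValent m aₘ (aₘ ∸ 1) 1
        × (Quotient n (Adj (TL n a (a ∸ 1) 1)) m ≅ TL m aₘ (aₘ ∸ 1) 1)
        × IsCover (n / m) (TL n a (a ∸ 1) 1) (TL m aₘ (aₘ ∸ 1) 1)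
theorem4p3 n _ primes≡1 zero n∣1 m m∣n 1<m _ =
  contradiction (∣1⇒≡1 (∣-trans m∣n n∣1)) (ℕ.>⇒≢ 1<m)
theorem4p3 n _ primes≡1 (suc b) n∣a²+1-a m m∣n 1<m _ =
  suc b , m∣a²+1-a , sixValent distinct , quotient≅ m∣n _ , isCover m∣n distinct
  where
  m∣a²+1-a : m ∣ suc b * suc b + 1 ∸ suc b
  m∣a²+1-a = ∣-trans m∣n n∣a²+1-a
  distinct : DistinctMod m (offsets (suc b ∷ b ∷ 1 ∷ []))
  distinct = offsets-distinct b m∣a²+1-a
    (divisor∤prime primes≡1 m∣n 1<m prime[2] λ ())
    (divisor∤prime primes≡1 m∣n 1<m (from-yes (prime? 3)) λ ())
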